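{- Let $R$ be a ring and $\tau\in\mathbf{M}_{\mathrm{stab}}(R)$. Then $\tau_H$ is cyclic: there exists $v\in\mathbf{V}_H(R)$ with $R[\tau_H]v=\mathbf{V}_H(R)$, and, equivalently, there exists $\ell\in\mathbf{V}_H^*(R)=\mathrm{Hom}_R(\mathbf{V}_H(R),R)$ with $\ell R[\tau_H]=\mathbf{V}_H^*(R)$.
   Context: Rings are commutative with $1$. Let $\mathbf{V}$ be a free $\mathbb{Z}$-module of finite rank, $\mathbf{V}^*=\mathrm{Hom}(\mathbf{V},\mathbb{Z})$; fix $e\in\mathbf{V}$, $e^*\in\mathbf{V}^*$ with $e^*(e)=1$. For a ring $R$: $\mathbf{V}(R)=\mathbf{V}\otimes R$, $\mathbf{V}^*(R)=\mathrm{Hom}_R(\mathbf{V}(R),R)$, $\mathbf{M}(R)=\mathrm{End}_R(\mathbf{V}(R))$; functionals are acted on from the right ($\ell x=\ell\circ x$). $\mathbf{V}_H(R)=\{v:e^*(v)=0\}$, so $\mathbf{V}(R)=\mathbf{V}_H(R)\oplus Re$; $1_H=1-ee^*$ (projection onto $\mathbf{V}_H(R)$ along $Re$), and $\tau_H=1_H\tau1_H$ restricted to $\mathbf{V}_H(R)$. $\tau$ is stable if $R[\tau]e=\mathbf{V}(R)$ and $e^*R[\tau]=\mathbf{V}^*(R)$; $\mathbf{M}_{\mathrm{stab}}(R)$ = stable elements. -}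

module Defs where

open import Level using (Level; _⊔_)
open import Algebra.Bundles using (CommutativeRing)
open import Data.Nat using (ℕ; zero; suc)
open import Data.Integer as ℤ using (ℤ; +_; -[1+_])
open import Data.Fin using (Fin; zero; suc)
import Data.Fin
import Relation.Nullary
open import Data.List using (List; []; _∷_)
open import Data.Product using (Σ; ∃; _×_; proj₁)
open import Relation.Binary.PropositionalEquality using (_≡_)

sumℤ : ∀ {n} → (Fin n → ℤ) → ℤ
sumℤ {zero}  f = + 0
sumℤ {suc n} f = f zero ℤ.+ sumℤ (λ i → f (suc i))

-- Pairing of an integer functional (coordinates w.r.t. dual basis) with an integer vector.
-- V = ℤ^n (a free ℤ-module of rank n with its standard basis), V* = ℤ^n (dual basis).
pairℤ : ∀ {n} → (Fin n → ℤ) → (Fin n → ℤ) → ℤ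
pairℤ ℓ v = sumℤ (λ i → ℓ i ℤ.* v i)

module Over {c ℓ : Level} (R : CommutativeRing c ℓ) where
  open CommutativeRing R using (_≈_; _+_; _*_; -_; _-_; 0#; 1#) renaming (Carrier to A)

  natR : ℕ → A
  natR zero    = 0#
  natR (suc k) = 1# + natR k

  fromℤ : ℤ → A
  fromℤ (+ k)      = natR k
  fromℤ -[1+ k ]   = - (natR (suc k))

  Σ[_] : ∀ {n} → (Fin n → A) → A
  Σ[_] {zero}  f = 0#
  Σ[_] {suc n} f = f zero + Σ[ (λ i → f (suc i)) ]

  -- V(R) = R^n (column vectors), V*(R) = Hom_R(R^n,R) identified with row vectors R^n,
  -- M(R) = End_R(R^n) = n×n matrices.
  Vec : ℕ → Set c
  Vec n = Fin n → A

  Mat : ℕ → Set c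
  Mat n = Fin n → Fin n → A

  _≈ᵥ_ : ∀ {n} → Vec n → Vec n → Set ℓ
  u ≈ᵥ v = ∀ i → u i ≈ v i

  0ᵥ : ∀ {n} → Vec n
  0ᵥ _ = 0#

  _+ᵥ_ : ∀ {n} → Vec n → Vec n → Vec n
  (u +ᵥ v) i = u i + v i

  _·ᵥ_ : ∀ {n} → A → Vec n → Vec n
  (r ·ᵥ v) i = r * v i

  _⊙_ : ∀ {n} → Mat n → Vec n → Vec n
  (x ⊙ v) i = Σ[ (λ j → x i j * v j) ]

  _⊙ʳ_ : ∀ {n} → Vec n → Mat n → Vec n
  (l ⊙ʳ x) j = Σ[ (λ i → l i * x i j) ]

  ⟨_,_⟩ : ∀ {n} → Vec n → Vec n → A
  ⟨ l , v ⟩ = Σ[ (λ i → l i * v i) ]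

  _∘ₘ_ : ∀ {n} → Mat n → Mat n → Mat n
  (x ∘ₘ y) i k = Σ[ (λ j → x i j * y j k) ]

  1ₘ : ∀ {n} → Mat n
  1ₘ i j with Data.Fin._≟_ i j
  ... | Relation.Nullary.yes _ = 1#
  ... | Relation.Nullary.no  _ = 0#

  -- Polynomials p = c₀ + c₁ X + … as coefficient lists.
  -- p(τ)v (Horner):  (c ∷ q)(τ) v = c v + τ (q(τ) v)
  polyAct : ∀ {n} → List A → Mat n → Vec n → Vec n
  polyAct []       τ v = 0ᵥ
  polyAct (c ∷ cs) τ v = (c ·ᵥ v) +ᵥ (τ ⊙ polyAct cs τ v)

  polyActʳ : ∀ {n} → List A → Mat n → Vec n → Vec n
  polyActʳ []       τ l = 0ᵥ
  polyActʳ (c ∷ cs) τ l = (c ·ᵥ l) +ᵥ (polyActʳ cs τ l ⊙ʳ τ)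

  module Frame {n : ℕ} (e e* : Fin n → ℤ) where
    eR : Vec n
    eR i = fromℤ (e i)

    e*R : Vec n
    e*R i = fromℤ (e* i)

    Stable : Mat n → Set (c ⊔ ℓ)
    Stable τ = (∀ (v : Vec n) → ∃ λ (p : List A) → polyAct p τ eR ≈ᵥ v)
             × (∀ (l : Vec n) → ∃ λ (p : List A) → polyActʳ p τ e*R ≈ᵥ l)

    VH : Set (c ⊔ ℓ)
    VH = Σ (Vec n) (λ v → ⟨ e*R , v ⟩ ≈ 0#)

    1H : Mat n
    1H i j = 1ₘ i j - eR i * e*R j

    -- τ_H is 1_H τ 1_H restricted to V_H (it preserves V_H).
    τHmat : Mat n → Mat n
    τHmat τ = 1H ∘ₘ (τ ∘ₘ 1H)

    -- V_H^*(R) = Hom_R(V_H(R), R): R-linear maps V_H(R) → R.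
    -- (Sums/scalings are expressed relationally on underlying vectors, which avoids
    --  building membership proofs; V_H(R) is closed under these operations.)
    record VH* : Set (c ⊔ ℓ) where
      field
        app   : VH → A
        resp  : ∀ (u v : VH) → proj₁ u ≈ᵥ proj₁ v → app u ≈ app v
        add   : ∀ (u v w : VH) → proj₁ w ≈ᵥ (proj₁ u +ᵥ proj₁ v) → app w ≈ app u + app v
        scale : ∀ (r : A) (u w : VH) → proj₁ w ≈ᵥ (r ·ᵥ proj₁ u) → app w ≈ r * app u
    open VH* public

    CyclicVec : Mat n → VH → Set (c ⊔ ℓ)
    CyclicVec τ v = ∀ (w : VH) → ∃ λ (p : List A) → polyAct p (τHmat τ) (proj₁ v) ≈ᵥ proj₁ w

    -- ℓ R[τ_H] = V_H^*(R): every m ∈ V_H^*(R) equals ℓ ∘ p(τ_H) for some p, i.e.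
    -- m(w) = ℓ(p(τ_H) w) for all w ∈ V_H(R)  (p(τ_H) w ∈ V_H(R)).
    CyclicCovec : Mat n → VH* → Set (c ⊔ ℓ)
    CyclicCovec τ l = ∀ (m : VH*) → ∃ λ (p : List A) →
      ∀ (w u : VH) → proj₁ u ≈ᵥ polyAct p (τHmat τ) (proj₁ w) → app m w ≈ app l u

module Submission where

-- Since e*(e) = 1, every u splits as e*(u) e + 1_H u, hence 1_H τ u = e*(u) v₀ + τ_H (1_H u)
-- with v₀ = 1_H τ e. Running this along Horner's scheme shows 1_H p(τ) e ∈ R[τ_H] v₀ for
-- every polynomial p, so R[τ]e = V(R) makes v₀ cyclic for τ_H. Dually, on V_H the functional
-- e* p(τ) equals ℓ₀ q(τ_H) for ℓ₀ = e* τ and some q; as every functional on V_H is the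
-- restriction of a row vector (its values on the columns of 1_H), e* R[τ] = V*(R) makes ℓ₀ cyclic.

open import Defs
open import Level using (Level)
open import Algebra.Bundles using (CommutativeRing)
open import Data.Nat using (ℕ)
open import Data.Integer using (ℤ; +_)
open import Data.Fin using (Fin)
open import Data.Product using (Σ; _×_)
open import Relation.Binary.PropositionalEquality using (_≡_)

import Data.Nat as ℕ
import Data.Nat.Properties as ℕ
import Data.Integer as ℤ
import Data.Integer.Properties as ℤ
open import Data.Fin using (zero; suc; _≟_)
open import Data.List using (List; []; _∷_)
open import Data.Product using (_,_; proj₁; proj₂; ∃)
open import Data.Sign using (Sign)
open import Function using (_∘_)
open import Relation.Nullary using (yes; no)
import Relation.Binary.PropositionalEquality as ≡
import Relation.Binary.Reasoning.Setoid as SetoidReasoning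
import Algebra.Properties.Ring as RingProperties
import Algebra.Properties.CommutativeSemigroup as CommutativeSemigroupProperties
import Algebra.Properties.Semiring.Sum as SemiringSum
import Algebra.Properties.Semiring.Mult as SemiringMult

module Linear {c ℓ : Level} (R : CommutativeRing c ℓ) where
  open CommutativeRing R hiding (zero) renaming (Carrier to A)
  open Over R
  open RingProperties ring using (-1*x≈-x; -0#≈0#; -‿involutive; -‿+-comm; -‿distribˡ-*; -‿distribʳ-*)
  open CommutativeSemigroupProperties +-commutativeSemigroup using (interchange) renaming (x∙yz≈y∙xz to x+[y+z]≈y+[x+z])
  open CommutativeSemigroupProperties *-commutativeSemigroup using () renaming (x∙yz≈y∙xz to x[yz]≈y[xz])
  open SemiringSum semiring using (sum; sum-cong-≋; sum-cong-≗; ∑-distrib-+; ∑-comm; *-distribˡ-sum; *-distribʳ-sum; sum-replicate-zero)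
  open SemiringMult semiring using (×-homo-+; ×1-homo-*) renaming (_×_ to _×′_)
  open SetoidReasoning setoid

  Σ≡sum : ∀ {n} (f : Vec n) → Σ[ f ] ≡ sum f
  Σ≡sum {ℕ.zero}  f = ≡.refl
  Σ≡sum {ℕ.suc n} f = ≡.cong (_+_ (f zero)) (Σ≡sum (f ∘ suc))

  Σ-cong : ∀ {n} {f g : Vec n} → f ≈ᵥ g → Σ[ f ] ≈ Σ[ g ]
  Σ-cong {f = f} {g} f≈g = begin
    Σ[ f ]  ≡⟨ Σ≡sum f ⟩
    sum f   ≈⟨ sum-cong-≋ f≈g ⟩
    sum g   ≡⟨ Σ≡sum g ⟨
    Σ[ g ]  ∎

  Σ-0 : ∀ {n} → Σ[ (λ (_ : Fin n) → 0#) ] ≈ 0#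
  Σ-0 {n} = trans (reflexive (Σ≡sum {n} _)) (sum-replicate-zero n)

  Σ-+ : ∀ {n} (f g : Vec n) → Σ[ f +ᵥ g ] ≈ Σ[ f ] + Σ[ g ]
  Σ-+ f g = begin
    Σ[ f +ᵥ g ]      ≡⟨ Σ≡sum (f +ᵥ g) ⟩
    sum (f +ᵥ g)     ≈⟨ ∑-distrib-+ f g ⟩
    sum f + sum g    ≡⟨ ≡.cong₂ _+_ (Σ≡sum f) (Σ≡sum g) ⟨
    Σ[ f ] + Σ[ g ]  ∎

  Σ-*ˡ : ∀ {n} r (f : Vec n) → Σ[ r ·ᵥ f ] ≈ r * Σ[ f ]
  Σ-*ˡ r f = begin
    Σ[ r ·ᵥ f ]  ≡⟨ Σ≡sum (r ·ᵥ f) ⟩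
    sum (r ·ᵥ f) ≈⟨ *-distribˡ-sum r f ⟨
    r * sum f    ≡⟨ ≡.cong (r *_) (Σ≡sum f) ⟨
    r * Σ[ f ]   ∎

  Σ-*ʳ : ∀ {n} r (f : Vec n) → Σ[ (λ i → f i * r) ] ≈ Σ[ f ] * r
  Σ-*ʳ {n} r f = begin
    Σ[ (λ i → f i * r) ]  ≡⟨ Σ≡sum {n} _ ⟩
    sum (λ i → f i * r)   ≈⟨ *-distribʳ-sum r f ⟨
    sum f * r             ≡⟨ ≡.cong (_* r) (Σ≡sum f) ⟨
    Σ[ f ] * r            ∎

  Σ-comm : ∀ {m n} (f : Fin m → Fin n → A) →
           Σ[ (λ i → Σ[ f i ]) ] ≈ Σ[ (λ j → Σ[ (λ i → f i j) ]) ]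
  Σ-comm {m} f = begin
    Σ[ (λ i → Σ[ f i ]) ]                ≡⟨ Σ≡sum {m} _ ⟩
    sum (λ i → Σ[ f i ])                 ≡⟨ sum-cong-≗ (λ i → Σ≡sum (f i)) ⟩
    sum (λ i → sum (f i))                ≈⟨ ∑-comm f ⟩
    sum (λ j → sum (λ i → f i j))        ≡⟨ sum-cong-≗ (λ j → Σ≡sum (λ i → f i j)) ⟨
    sum (λ j → Σ[ (λ i → f i j) ])       ≡⟨ Σ≡sum (λ j → Σ[ (λ i → f i j) ]) ⟨
    Σ[ (λ j → Σ[ (λ i → f i j) ]) ]      ∎

  1ₘ-suc : ∀ {n} (i j : Fin n) → 1ₘ (suc i) (suc j) ≡ 1ₘ i j
  1ₘ-suc i j with i ≟ j
  ... | yes _ = ≡.refl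
  ... | no _  = ≡.refl

  1ₘ-⊙ : ∀ {n} (u : Vec n) → (1ₘ ⊙ u) ≈ᵥ u
  1ₘ-⊙ {ℕ.suc n} u zero = begin
    1# * u zero + Σ[ (λ j → 0# * u (suc j)) ]  ≈⟨ +-cong (*-identityˡ _) (Σ-cong {n} (λ j → zeroˡ _)) ⟩
    u zero + Σ[ (λ (_ : Fin n) → 0#) ]          ≈⟨ +-congˡ (Σ-0 {n}) ⟩
    u zero + 0#                                ≈⟨ +-identityʳ _ ⟩
    u zero                                     ∎
  1ₘ-⊙ {ℕ.suc n} u (suc i) = begin
    0# * u zero + Σ[ (λ j → 1ₘ (suc i) (suc j) * u (suc j)) ]  ≈⟨ +-cong (zeroˡ _) (Σ-cong (λ j → *-congʳ (reflexive (1ₘ-suc i j)))) ⟩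
    0# + (1ₘ ⊙ (u ∘ suc)) i                                    ≈⟨ +-identityˡ _ ⟩
    (1ₘ ⊙ (u ∘ suc)) i                                         ≈⟨ 1ₘ-⊙ (u ∘ suc) i ⟩
    u (suc i)                                                  ∎

  ⊙ʳ-1ₘ : ∀ {n} (l : Vec n) → (l ⊙ʳ 1ₘ) ≈ᵥ l
  ⊙ʳ-1ₘ {ℕ.suc n} l zero = begin
    l zero * 1# + Σ[ (λ i → l (suc i) * 0#) ]  ≈⟨ +-cong (*-identityʳ _) (Σ-cong {n} (λ i → zeroʳ _)) ⟩
    l zero + Σ[ (λ (_ : Fin n) → 0#) ]          ≈⟨ +-congˡ (Σ-0 {n}) ⟩
    l zero + 0#                                ≈⟨ +-identityʳ _ ⟩
    l zero                                     ∎
  ⊙ʳ-1ₘ {ℕ.suc n} l (suc j) = begin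
    l zero * 0# + Σ[ (λ i → l (suc i) * 1ₘ (suc i) (suc j)) ]  ≈⟨ +-cong (zeroʳ _) (Σ-cong (λ i → *-congˡ (reflexive (1ₘ-suc i j)))) ⟩
    0# + ((l ∘ suc) ⊙ʳ 1ₘ) j                                   ≈⟨ +-identityˡ _ ⟩
    ((l ∘ suc) ⊙ʳ 1ₘ) j                                        ≈⟨ ⊙ʳ-1ₘ (l ∘ suc) j ⟩
    l (suc j)                                                  ∎

  module _ {n : ℕ} where
    pairing-cong : ∀ {l l′ u u′ : Vec n} → l ≈ᵥ l′ → u ≈ᵥ u′ → ⟨ l , u ⟩ ≈ ⟨ l′ , u′ ⟩
    pairing-cong l≈l′ u≈u′ = Σ-cong (λ i → *-cong (l≈l′ i) (u≈u′ i))

    pairing-congʳ : ∀ (l : Vec n) {u u′ : Vec n} → u ≈ᵥ u′ → ⟨ l , u ⟩ ≈ ⟨ l , u′ ⟩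
    pairing-congʳ l = pairing-cong (λ _ → refl)

    pairing-comm : ∀ (l u : Vec n) → ⟨ l , u ⟩ ≈ ⟨ u , l ⟩
    pairing-comm l u = Σ-cong (λ i → *-comm (l i) (u i))

    pairing-+ʳ : ∀ (l u v : Vec n) → ⟨ l , u +ᵥ v ⟩ ≈ ⟨ l , u ⟩ + ⟨ l , v ⟩
    pairing-+ʳ l u v = trans (Σ-cong (λ i → distribˡ (l i) (u i) (v i))) (Σ-+ (λ i → l i * u i) (λ i → l i * v i))

    pairing-·ʳ : ∀ (l : Vec n) r (u : Vec n) → ⟨ l , r ·ᵥ u ⟩ ≈ r * ⟨ l , u ⟩
    pairing-·ʳ l r u = trans (Σ-cong (λ i → x[yz]≈y[xz] (l i) r (u i))) (Σ-*ˡ r (λ i → l i * u i))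

    pairing-0ʳ : ∀ (l : Vec n) → ⟨ l , 0ᵥ ⟩ ≈ 0#
    pairing-0ʳ l = trans (Σ-cong (λ i → zeroʳ (l i))) (Σ-0 {n})

    pairing-+ˡ : ∀ (l l′ u : Vec n) → ⟨ l +ᵥ l′ , u ⟩ ≈ ⟨ l , u ⟩ + ⟨ l′ , u ⟩
    pairing-+ˡ l l′ u = trans (pairing-comm _ u) (trans (pairing-+ʳ u l l′) (+-cong (pairing-comm u l) (pairing-comm u l′)))

    pairing-·ˡ : ∀ r (l u : Vec n) → ⟨ r ·ᵥ l , u ⟩ ≈ r * ⟨ l , u ⟩
    pairing-·ˡ r l u = trans (pairing-comm _ u) (trans (pairing-·ʳ u r l) (*-congˡ (pairing-comm u l)))

    pairing-0ˡ : ∀ (u : Vec n) → ⟨ 0ᵥ , u ⟩ ≈ 0#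
    pairing-0ˡ u = trans (pairing-comm 0ᵥ u) (pairing-0ʳ u)

    pairing-⊙ʳ : ∀ (l : Vec n) (x : Mat n) (u : Vec n) → ⟨ l ⊙ʳ x , u ⟩ ≈ ⟨ l , x ⊙ u ⟩
    pairing-⊙ʳ l x u = begin
      Σ[ (λ j → Σ[ (λ i → l i * x i j) ] * u j) ]  ≈⟨ Σ-cong (λ j → Σ-*ʳ (u j) (λ i → l i * x i j)) ⟨
      Σ[ (λ j → Σ[ (λ i → l i * x i j * u j) ]) ]  ≈⟨ Σ-comm (λ j i → l i * x i j * u j) ⟩
      Σ[ (λ i → Σ[ (λ j → l i * x i j * u j) ]) ]  ≈⟨ Σ-cong (λ i → trans (Σ-cong (λ j → *-assoc (l i) (x i j) (u j))) (Σ-*ˡ (l i) (λ j → x i j * u j))) ⟩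
      Σ[ (λ i → l i * (x ⊙ u) i) ]                ∎

    ⊙-congʳ : ∀ (x : Mat n) {u v : Vec n} → u ≈ᵥ v → (x ⊙ u) ≈ᵥ (x ⊙ v)
    ⊙-congʳ x u≈v i = pairing-congʳ (x i) u≈v

    ⊙-+ : ∀ (x : Mat n) (u v : Vec n) → (x ⊙ (u +ᵥ v)) ≈ᵥ ((x ⊙ u) +ᵥ (x ⊙ v))
    ⊙-+ x u v i = pairing-+ʳ (x i) u v

    ⊙-· : ∀ (x : Mat n) r (u : Vec n) → (x ⊙ (r ·ᵥ u)) ≈ᵥ (r ·ᵥ (x ⊙ u))
    ⊙-· x r u i = pairing-·ʳ (x i) r u

    ⊙-0 : ∀ (x : Mat n) → (x ⊙ 0ᵥ) ≈ᵥ 0ᵥ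
    ⊙-0 x i = pairing-0ʳ (x i)

    ∘ₘ-⊙ : ∀ (x y : Mat n) (u : Vec n) → ((x ∘ₘ y) ⊙ u) ≈ᵥ (x ⊙ (y ⊙ u))
    ∘ₘ-⊙ x y u i = pairing-⊙ʳ (x i) y u

    polyAct-congʳ : ∀ (p : List A) (x : Mat n) {u v : Vec n} → u ≈ᵥ v → polyAct p x u ≈ᵥ polyAct p x v
    polyAct-congʳ []      x u≈v i = refl
    polyAct-congʳ (a ∷ p) x u≈v i = +-cong (*-congˡ (u≈v i)) (⊙-congʳ x (polyAct-congʳ p x u≈v) i)

    polyAct-comm : ∀ (p : List A) (x : Mat n) (u : Vec n) → polyAct p x (x ⊙ u) ≈ᵥ (x ⊙ polyAct p x u)
    polyAct-comm []      x u i = sym (⊙-0 x i)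
    polyAct-comm (a ∷ p) x u i = begin
      a * (x ⊙ u) i + (x ⊙ polyAct p x (x ⊙ u)) i  ≈⟨ +-cong (sym (⊙-· x a u i)) (⊙-congʳ x (polyAct-comm p x u) i) ⟩
      (x ⊙ (a ·ᵥ u)) i + (x ⊙ (x ⊙ polyAct p x u)) i ≈⟨ ⊙-+ x _ _ i ⟨
      (x ⊙ polyAct (a ∷ p) x u) i                  ∎

  natR≡×1# : ∀ k → natR k ≡ k ×′ 1#
  natR≡×1# ℕ.zero    = ≡.refl
  natR≡×1# (ℕ.suc k) = ≡.cong (_+_ 1#) (natR≡×1# k)

  natR-+ : ∀ m k → natR (m ℕ.+ k) ≈ natR m + natR k
  natR-+ m k = begin
    natR (m ℕ.+ k)          ≡⟨ natR≡×1# (m ℕ.+ k) ⟩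
    (m ℕ.+ k) ×′ 1#         ≈⟨ ×-homo-+ 1# m k ⟩
    m ×′ 1# + k ×′ 1#       ≡⟨ ≡.cong₂ _+_ (natR≡×1# m) (natR≡×1# k) ⟨
    natR m + natR k         ∎

  natR-* : ∀ m k → natR (m ℕ.* k) ≈ natR m * natR k
  natR-* m k = begin
    natR (m ℕ.* k)          ≡⟨ natR≡×1# (m ℕ.* k) ⟩
    (m ℕ.* k) ×′ 1#         ≈⟨ ×1-homo-* m k ⟩
    m ×′ 1# * (k ×′ 1#)     ≡⟨ ≡.cong₂ _*_ (natR≡×1# m) (natR≡×1# k) ⟨
    natR m * natR k         ∎

  fromℤ-⊖ : ∀ m k → fromℤ (m ℤ.⊖ k) ≈ natR m - natR k
  fromℤ-⊖ ℕ.zero    ℕ.zero    = sym (-‿inverseʳ 0#)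
  fromℤ-⊖ (ℕ.suc m) ℕ.zero    = sym (trans (+-congˡ -0#≈0#) (+-identityʳ _))
  fromℤ-⊖ ℕ.zero    (ℕ.suc k) = sym (+-identityˡ _)
  fromℤ-⊖ (ℕ.suc m) (ℕ.suc k) = begin
    fromℤ (ℕ.suc m ℤ.⊖ ℕ.suc k)        ≡⟨ ≡.cong fromℤ (ℤ.[1+m]⊖[1+n]≡m⊖n m k) ⟩
    fromℤ (m ℤ.⊖ k)                    ≈⟨ fromℤ-⊖ m k ⟩
    natR m - natR k                    ≈⟨ +-identityˡ _ ⟨
    0# + (natR m - natR k)             ≈⟨ +-congʳ (-‿inverseʳ 1#) ⟨
    (1# - 1#) + (natR m - natR k)      ≈⟨ interchange 1# (- 1#) (natR m) (- natR k) ⟩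
    natR (ℕ.suc m) + (- 1# - natR k)   ≈⟨ +-congˡ (-‿+-comm 1# (natR k)) ⟩
    natR (ℕ.suc m) - natR (ℕ.suc k)    ∎

  fromℤ-+ : ∀ i j → fromℤ (i ℤ.+ j) ≈ fromℤ i + fromℤ j
  fromℤ-+ (+ m)      (+ k)      = natR-+ m k
  fromℤ-+ (+ m)      ℤ.-[1+ k ] = fromℤ-⊖ m (ℕ.suc k)
  fromℤ-+ ℤ.-[1+ m ] (+ k)      = trans (fromℤ-⊖ k (ℕ.suc m)) (+-comm _ _)
  fromℤ-+ ℤ.-[1+ m ] ℤ.-[1+ k ] = begin
    - natR (ℕ.suc (ℕ.suc (m ℕ.+ k)))          ≡⟨ ≡.cong (-_ ∘ natR ∘ ℕ.suc) (ℕ.+-suc m k) ⟨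
    - natR (ℕ.suc m ℕ.+ ℕ.suc k)              ≈⟨ -‿cong (natR-+ (ℕ.suc m) (ℕ.suc k)) ⟩
    - (natR (ℕ.suc m) + natR (ℕ.suc k))       ≈⟨ -‿+-comm _ _ ⟨
    - natR (ℕ.suc m) + - natR (ℕ.suc k)       ∎

  fromℤ-+◃ : ∀ k → fromℤ (Sign.+ ℤ.◃ k) ≈ natR k
  fromℤ-+◃ k = reflexive (≡.cong fromℤ (ℤ.+◃n≡+n k))

  fromℤ--◃ : ∀ k → fromℤ (Sign.- ℤ.◃ k) ≈ - natR k
  fromℤ--◃ ℕ.zero    = sym -0#≈0#
  fromℤ--◃ (ℕ.suc k) = refl

  -x*-y≈x*y : ∀ x y → - x * - y ≈ x * y
  -x*-y≈x*y x y = begin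
    - x * - y      ≈⟨ -‿distribˡ-* x (- y) ⟨
    - (x * - y)    ≈⟨ -‿cong (-‿distribʳ-* x y) ⟨
    - - (x * y)    ≈⟨ -‿involutive _ ⟩
    x * y          ∎

  fromℤ-* : ∀ i j → fromℤ (i ℤ.* j) ≈ fromℤ i * fromℤ j
  fromℤ-* (+ m)      (+ k)      = trans (fromℤ-+◃ (m ℕ.* k)) (natR-* m k)
  fromℤ-* (+ m)      ℤ.-[1+ k ] = begin
    fromℤ (Sign.- ℤ.◃ m ℕ.* ℕ.suc k)   ≈⟨ fromℤ--◃ (m ℕ.* ℕ.suc k) ⟩
    - natR (m ℕ.* ℕ.suc k)             ≈⟨ -‿cong (natR-* m (ℕ.suc k)) ⟩
    - (natR m * natR (ℕ.suc k))        ≈⟨ -‿distribʳ-* _ _ ⟩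
    natR m * - natR (ℕ.suc k)          ∎
  fromℤ-* ℤ.-[1+ m ] (+ k)      = begin
    fromℤ (Sign.- ℤ.◃ ℕ.suc m ℕ.* k)   ≈⟨ fromℤ--◃ (ℕ.suc m ℕ.* k) ⟩
    - natR (ℕ.suc m ℕ.* k)             ≈⟨ -‿cong (natR-* (ℕ.suc m) k) ⟩
    - (natR (ℕ.suc m) * natR k)        ≈⟨ -‿distribˡ-* _ _ ⟩
    - natR (ℕ.suc m) * natR k          ∎
  fromℤ-* ℤ.-[1+ m ] ℤ.-[1+ k ] = begin
    fromℤ (Sign.+ ℤ.◃ ℕ.suc m ℕ.* ℕ.suc k)  ≈⟨ fromℤ-+◃ (ℕ.suc m ℕ.* ℕ.suc k) ⟩
    natR (ℕ.suc m ℕ.* ℕ.suc k)              ≈⟨ natR-* (ℕ.suc m) (ℕ.suc k) ⟩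
    natR (ℕ.suc m) * natR (ℕ.suc k)         ≈⟨ -x*-y≈x*y _ _ ⟨
    - natR (ℕ.suc m) * - natR (ℕ.suc k)     ∎

  fromℤ-pairℤ : ∀ {n} (l v : Fin n → ℤ) → fromℤ (pairℤ l v) ≈ ⟨ fromℤ ∘ l , fromℤ ∘ v ⟩
  fromℤ-pairℤ {ℕ.zero}  l v = refl
  fromℤ-pairℤ {ℕ.suc n} l v = begin
    fromℤ (l zero ℤ.* v zero ℤ.+ pairℤ (l ∘ suc) (v ∘ suc))        ≈⟨ fromℤ-+ (l zero ℤ.* v zero) (pairℤ (l ∘ suc) (v ∘ suc)) ⟩
    fromℤ (l zero ℤ.* v zero) + fromℤ (pairℤ (l ∘ suc) (v ∘ suc))  ≈⟨ +-cong (fromℤ-* (l zero) (v zero)) (fromℤ-pairℤ (l ∘ suc) (v ∘ suc)) ⟩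
    ⟨ fromℤ ∘ l , fromℤ ∘ v ⟩                                      ∎

  fromℤ-pairℤ≡1 : ∀ {n} (l v : Fin n → ℤ) → pairℤ l v ≡ + 1 → ⟨ fromℤ ∘ l , fromℤ ∘ v ⟩ ≈ 1#
  fromℤ-pairℤ≡1 l v lv≡1 = begin
    ⟨ fromℤ ∘ l , fromℤ ∘ v ⟩  ≈⟨ fromℤ-pairℤ l v ⟨
    fromℤ (pairℤ l v)          ≡⟨ ≡.cong fromℤ lv≡1 ⟩
    1# + 0#                    ≈⟨ +-identityʳ 1# ⟩
    1#                         ∎

  basis : ∀ {n} → Fin n → Vec n
  basis j i = 1ₘ i j

  module Hyperplane {n : ℕ} (e e* : Fin n → ℤ) (e*e≈1 : ⟨ Frame.e*R e e* , Frame.eR e e* ⟩ ≈ 1#) where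
    open Frame e e*

    1H-⊙ : ∀ (u : Vec n) → (1H ⊙ u) ≈ᵥ (u +ᵥ ((- ⟨ e*R , u ⟩) ·ᵥ eR))
    1H-⊙ u i = begin
      Σ[ (λ j → (1ₘ i j - eR i * e*R j) * u j) ]                  ≈⟨ Σ-cong (λ j → trans (distribʳ (u j) _ _) (+-congˡ (entry j))) ⟩
      Σ[ (λ j → 1ₘ i j * u j + (- eR i) * (e*R j * u j)) ]        ≈⟨ Σ-+ (λ j → 1ₘ i j * u j) (λ j → (- eR i) * (e*R j * u j)) ⟩
      (1ₘ ⊙ u) i + Σ[ (- eR i) ·ᵥ (λ j → e*R j * u j) ]           ≈⟨ +-cong (1ₘ-⊙ u i) (Σ-*ˡ (- eR i) (λ j → e*R j * u j)) ⟩
      u i + (- eR i) * ⟨ e*R , u ⟩                                ≈⟨ +-congˡ (trans (sym (-‿distribˡ-* _ _)) (trans (-‿cong (*-comm _ _)) (-‿distribˡ-* _ _))) ⟩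
      u i + (- ⟨ e*R , u ⟩) * eR i                                ∎
      where
        entry : ∀ j → - (eR i * e*R j) * u j ≈ (- eR i) * (e*R j * u j)
        entry j = trans (*-congʳ (-‿distribˡ-* _ _)) (*-assoc _ _ _)

    e*-1H : ∀ (u : Vec n) → ⟨ e*R , 1H ⊙ u ⟩ ≈ 0#
    e*-1H u = begin
      ⟨ e*R , 1H ⊙ u ⟩                    ≈⟨ pairing-congʳ e*R (1H-⊙ u) ⟩
      ⟨ e*R , u +ᵥ ((- a) ·ᵥ eR) ⟩        ≈⟨ pairing-+ʳ e*R u ((- a) ·ᵥ eR) ⟩
      a + ⟨ e*R , (- a) ·ᵥ eR ⟩           ≈⟨ +-congˡ (pairing-·ʳ e*R (- a) eR) ⟩
      a + (- a) * ⟨ e*R , eR ⟩            ≈⟨ +-congˡ (trans (*-congˡ e*e≈1) (*-identityʳ _)) ⟩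
      a - a                               ≈⟨ -‿inverseʳ a ⟩
      0#                                  ∎
      where a = ⟨ e*R , u ⟩

    1H-fix : ∀ {u : Vec n} → ⟨ e*R , u ⟩ ≈ 0# → (1H ⊙ u) ≈ᵥ u
    1H-fix {u} e*u≈0 i = begin
      (1H ⊙ u) i                    ≈⟨ 1H-⊙ u i ⟩
      u i + (- ⟨ e*R , u ⟩) * eR i  ≈⟨ +-congˡ (*-congʳ (trans (-‿cong e*u≈0) -0#≈0#)) ⟩
      u i + 0# * eR i               ≈⟨ +-congˡ (zeroˡ _) ⟩
      u i + 0#                      ≈⟨ +-identityʳ _ ⟩
      u i                           ∎

    1H-eR : (1H ⊙ eR) ≈ᵥ 0ᵥ
    1H-eR i = begin
      (1H ⊙ eR) i                       ≈⟨ 1H-⊙ eR i ⟩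
      eR i + (- ⟨ e*R , eR ⟩) * eR i    ≈⟨ +-congˡ (*-congʳ (-‿cong e*e≈1)) ⟩
      eR i + (- 1#) * eR i              ≈⟨ +-congˡ (-1*x≈-x _) ⟩
      eR i - eR i                       ≈⟨ -‿inverseʳ _ ⟩
      0#                                ∎

    decomposition : ∀ (u : Vec n) → u ≈ᵥ ((⟨ e*R , u ⟩ ·ᵥ eR) +ᵥ (1H ⊙ u))
    decomposition u i = sym (begin
      a * eR i + (1H ⊙ u) i             ≈⟨ +-congˡ (1H-⊙ u i) ⟩
      a * eR i + (u i + (- a) * eR i)   ≈⟨ x+[y+z]≈y+[x+z] _ _ _ ⟩
      u i + (a * eR i + (- a) * eR i)   ≈⟨ +-congˡ (distribʳ _ _ _) ⟨
      u i + (a - a) * eR i              ≈⟨ +-congˡ (trans (*-congʳ (-‿inverseʳ a)) (zeroˡ _)) ⟩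
      u i + 0#                          ≈⟨ +-identityʳ _ ⟩
      u i                               ∎)
      where a = ⟨ e*R , u ⟩

    0ᴴ : VH
    0ᴴ = 0ᵥ , pairing-0ʳ e*R

    _+ᴴ_ : VH → VH → VH
    (u , e*u≈0) +ᴴ (v , e*v≈0) = u +ᵥ v , trans (pairing-+ʳ e*R u v) (trans (+-cong e*u≈0 e*v≈0) (+-identityʳ 0#))

    _·ᴴ_ : A → VH → VH
    r ·ᴴ (u , e*u≈0) = r ·ᵥ u , trans (pairing-·ʳ e*R r u) (trans (*-congˡ e*u≈0) (zeroʳ r))

    combination : ∀ {k} → (Fin k → A) → (Fin k → VH) → VH
    combination {ℕ.zero}  f w = 0ᴴ
    combination {ℕ.suc k} f w = (f zero ·ᴴ w zero) +ᴴ combination (f ∘ suc) (w ∘ suc)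

    proj₁-combination : ∀ {k} (f : Fin k → A) (w : Fin k → VH) →
                    proj₁ (combination f w) ≈ᵥ (λ i → Σ[ (λ j → f j * proj₁ (w j) i) ])
    proj₁-combination {ℕ.zero}  f w i = refl
    proj₁-combination {ℕ.suc k} f w i = +-congˡ (proj₁-combination (f ∘ suc) (w ∘ suc) i)

    app-combination : ∀ (m : VH*) {k} (f : Fin k → A) (w : Fin k → VH) →
                      app m (combination f w) ≈ Σ[ (λ j → f j * app m (w j)) ]
    app-combination m {ℕ.zero}  f w = trans (scale m 0# 0ᴴ 0ᴴ (λ _ → sym (zeroˡ 0#))) (zeroˡ _)
    app-combination m {ℕ.suc k} f w =
      trans (add m (f zero ·ᴴ w zero) (combination (f ∘ suc) (w ∘ suc)) _ (λ _ → refl))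
            (+-cong (scale m (f zero) (w zero) _ (λ _ → refl)) (app-combination m (f ∘ suc) (w ∘ suc)))

    1H-basis : Fin n → VH
    1H-basis j = 1H ⊙ basis j , e*-1H (basis j)

    coordinates : VH* → Vec n
    coordinates m j = app m (1H-basis j)

    VH-expansion : ∀ (w : VH) → proj₁ w ≈ᵥ proj₁ (combination (proj₁ w) 1H-basis)
    VH-expansion (w , e*w≈0) i = begin
      w i                                          ≈⟨ 1H-fix e*w≈0 i ⟨
      Σ[ (λ j → 1H i j * w j) ]                    ≈⟨ Σ-cong (λ j → trans (*-comm _ _) (*-congˡ (sym (⊙ʳ-1ₘ (1H i) j)))) ⟩
      Σ[ (λ j → w j * (1H ⊙ basis j) i) ]          ≈⟨ proj₁-combination w 1H-basis i ⟨
      proj₁ (combination w 1H-basis) i             ∎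

    app-coordinates : ∀ (m : VH*) (w : VH) → app m w ≈ ⟨ coordinates m , proj₁ w ⟩
    app-coordinates m w = begin
      app m w                                       ≈⟨ resp m w _ (VH-expansion w) ⟩
      app m (combination (proj₁ w) 1H-basis)        ≈⟨ app-combination m (proj₁ w) 1H-basis ⟩
      ⟨ proj₁ w , coordinates m ⟩                   ≈⟨ pairing-comm (proj₁ w) (coordinates m) ⟩
      ⟨ coordinates m , proj₁ w ⟩                   ∎

    restrict : Vec n → VH*
    restrict φ = record
      { app   = λ u → ⟨ φ , proj₁ u ⟩
      ; resp  = λ u v u≈v → pairing-congʳ φ u≈v
      ; add   = λ u v w w≈u+v → trans (pairing-congʳ φ w≈u+v) (pairing-+ʳ φ (proj₁ u) (proj₁ v))
      ; scale = λ r u w w≈ru → trans (pairing-congʳ φ w≈ru) (pairing-·ʳ φ r (proj₁ u))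
      }

    module _ (τ : Mat n) where
      τH : Mat n
      τH = τHmat τ

      τH-⊙ : ∀ (u : Vec n) → (τH ⊙ u) ≈ᵥ (1H ⊙ (τ ⊙ (1H ⊙ u)))
      τH-⊙ u i = trans (∘ₘ-⊙ 1H (τ ∘ₘ 1H) u i) (⊙-congʳ 1H (∘ₘ-⊙ τ 1H u) i)

      τH-⊙-VH : ∀ {u : Vec n} → ⟨ e*R , u ⟩ ≈ 0# → (τH ⊙ u) ≈ᵥ (1H ⊙ (τ ⊙ u))
      τH-⊙-VH {u} e*u≈0 i = trans (τH-⊙ u i) (⊙-congʳ 1H (⊙-congʳ τ (1H-fix e*u≈0)) i)

      e*-τH : ∀ (u : Vec n) → ⟨ e*R , τH ⊙ u ⟩ ≈ 0#
      e*-τH u = trans (pairing-congʳ e*R (τH-⊙ u)) (e*-1H (τ ⊙ (1H ⊙ u)))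

      v₀ : Vec n
      v₀ = 1H ⊙ (τ ⊙ eR)

      ℓ₀ : Vec n
      ℓ₀ = e*R ⊙ʳ τ

      1H-horner : ∀ c (u : Vec n) →
                  (1H ⊙ ((c ·ᵥ eR) +ᵥ (τ ⊙ u))) ≈ᵥ ((⟨ e*R , u ⟩ ·ᵥ v₀) +ᵥ (τH ⊙ (1H ⊙ u)))
      1H-horner c u i = begin
        (1H ⊙ ((c ·ᵥ eR) +ᵥ (τ ⊙ u))) i                         ≈⟨ ⊙-+ 1H (c ·ᵥ eR) (τ ⊙ u) i ⟩
        (1H ⊙ (c ·ᵥ eR)) i + (1H ⊙ (τ ⊙ u)) i                   ≈⟨ +-congʳ (trans (⊙-· 1H c eR i) (trans (*-congˡ (1H-eR i)) (zeroʳ c))) ⟩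
        0# + (1H ⊙ (τ ⊙ u)) i                                    ≈⟨ +-identityˡ _ ⟩
        (1H ⊙ (τ ⊙ u)) i                                         ≈⟨ ⊙-congʳ 1H (⊙-congʳ τ (decomposition u)) i ⟩
        (1H ⊙ (τ ⊙ ((a ·ᵥ eR) +ᵥ (1H ⊙ u)))) i                  ≈⟨ ⊙-congʳ 1H (⊙-+ τ (a ·ᵥ eR) (1H ⊙ u)) i ⟩
        (1H ⊙ ((τ ⊙ (a ·ᵥ eR)) +ᵥ (τ ⊙ (1H ⊙ u)))) i            ≈⟨ ⊙-+ 1H (τ ⊙ (a ·ᵥ eR)) (τ ⊙ (1H ⊙ u)) i ⟩
        (1H ⊙ (τ ⊙ (a ·ᵥ eR))) i + (1H ⊙ (τ ⊙ (1H ⊙ u))) i     ≈⟨ +-cong (trans (⊙-congʳ 1H (⊙-· τ a eR) i) (⊙-· 1H a (τ ⊙ eR) i))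
                                                                          (sym (τH-⊙-VH (e*-1H u) i)) ⟩
        a * v₀ i + (τH ⊙ (1H ⊙ u)) i                              ∎
        where a = ⟨ e*R , u ⟩

      1H-polyAct : ∀ (p : List A) → ∃ λ q → polyAct q τH v₀ ≈ᵥ (1H ⊙ polyAct p τ eR)
      1H-polyAct []      = [] , λ i → sym (⊙-0 1H i)
      1H-polyAct (c ∷ p) with 1H-polyAct p
      ... | q , q[τH]v₀≈1Hu =
        ⟨ e*R , polyAct p τ eR ⟩ ∷ q ,
        λ i → trans (+-congˡ (⊙-congʳ τH q[τH]v₀≈1Hu i)) (sym (1H-horner c (polyAct p τ eR) i))

      cyclicVector : (∀ (v : Vec n) → ∃ λ p → polyAct p τ eR ≈ᵥ v) → Σ VH (CyclicVec τ)
      cyclicVector e-generates = (v₀ , e*-1H (τ ⊙ eR)) , generates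
        where
          generates : CyclicVec τ (v₀ , e*-1H (τ ⊙ eR))
          generates (w , e*w≈0) with e-generates w
          ... | p , p[τ]e≈w with 1H-polyAct p
          ... | q , q[τH]v₀≈1Hp[τ]e =
            q , λ i → trans (q[τH]v₀≈1Hp[τ]e i) (trans (⊙-congʳ 1H p[τ]e≈w i) (1H-fix e*w≈0 i))

      pairing-horner : ∀ c (φ : Vec n) {z : Vec n} → ⟨ e*R , z ⟩ ≈ 0# →
                       ⟨ (c ·ᵥ e*R) +ᵥ (φ ⊙ʳ τ) , z ⟩ ≈ ⟨ φ , eR ⟩ * ⟨ ℓ₀ , z ⟩ + ⟨ φ , τH ⊙ z ⟩
      pairing-horner c φ {z} e*z≈0 = begin
        ⟨ (c ·ᵥ e*R) +ᵥ (φ ⊙ʳ τ) , z ⟩          ≈⟨ pairing-+ˡ (c ·ᵥ e*R) (φ ⊙ʳ τ) z ⟩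
        ⟨ c ·ᵥ e*R , z ⟩ + ⟨ φ ⊙ʳ τ , z ⟩        ≈⟨ +-cong (trans (pairing-·ˡ c e*R z) (trans (*-congˡ e*z≈0) (zeroʳ c)))
                                                          (pairing-⊙ʳ φ τ z) ⟩
        0# + ⟨ φ , τ ⊙ z ⟩                       ≈⟨ +-identityˡ _ ⟩
        ⟨ φ , τ ⊙ z ⟩                            ≈⟨ pairing-congʳ φ (decomposition (τ ⊙ z)) ⟩
        ⟨ φ , (b ·ᵥ eR) +ᵥ (1H ⊙ (τ ⊙ z)) ⟩      ≈⟨ pairing-+ʳ φ (b ·ᵥ eR) (1H ⊙ (τ ⊙ z)) ⟩
        ⟨ φ , b ·ᵥ eR ⟩ + ⟨ φ , 1H ⊙ (τ ⊙ z) ⟩   ≈⟨ +-cong (trans (pairing-·ʳ φ b eR) (*-comm b _))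
                                                          (pairing-congʳ φ (λ i → sym (τH-⊙-VH e*z≈0 i))) ⟩
        ⟨ φ , eR ⟩ * b + ⟨ φ , τH ⊙ z ⟩          ≈⟨ +-congʳ (*-congˡ (pairing-⊙ʳ e*R τ z)) ⟨
        ⟨ φ , eR ⟩ * ⟨ ℓ₀ , z ⟩ + ⟨ φ , τH ⊙ z ⟩ ∎
        where b = ⟨ e*R , τ ⊙ z ⟩

      restrict-polyActʳ : ∀ (p : List A) → ∃ λ q → ∀ {z : Vec n} → ⟨ e*R , z ⟩ ≈ 0# →
                          ⟨ polyActʳ p τ e*R , z ⟩ ≈ ⟨ ℓ₀ , polyAct q τH z ⟩
      restrict-polyActʳ []      = [] , λ {z} _ → trans (pairing-0ˡ z) (sym (pairing-0ʳ ℓ₀))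
      restrict-polyActʳ (c ∷ p) with restrict-polyActʳ p
      ... | q , agree = k ∷ q , λ {z} e*z≈0 → begin
        ⟨ polyActʳ (c ∷ p) τ e*R , z ⟩                    ≈⟨ pairing-horner c φ e*z≈0 ⟩
        k * ⟨ ℓ₀ , z ⟩ + ⟨ φ , τH ⊙ z ⟩                    ≈⟨ +-congˡ (agree (e*-τH z)) ⟩
        k * ⟨ ℓ₀ , z ⟩ + ⟨ ℓ₀ , polyAct q τH (τH ⊙ z) ⟩    ≈⟨ +-congˡ (pairing-congʳ ℓ₀ (polyAct-comm q τH z)) ⟩
        k * ⟨ ℓ₀ , z ⟩ + ⟨ ℓ₀ , τH ⊙ polyAct q τH z ⟩      ≈⟨ +-congʳ (pairing-·ʳ ℓ₀ k z) ⟨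
        ⟨ ℓ₀ , k ·ᵥ z ⟩ + ⟨ ℓ₀ , τH ⊙ polyAct q τH z ⟩     ≈⟨ pairing-+ʳ ℓ₀ (k ·ᵥ z) (τH ⊙ polyAct q τH z) ⟨
        ⟨ ℓ₀ , polyAct (k ∷ q) τH z ⟩                     ∎
        where
          φ = polyActʳ p τ e*R
          k = ⟨ φ , eR ⟩

      cyclicCovector : (∀ (l : Vec n) → ∃ λ p → polyActʳ p τ e*R ≈ᵥ l) → Σ VH* (CyclicCovec τ)
      cyclicCovector e*-generates = restrict ℓ₀ , generates
        where
          generates : CyclicCovec τ (restrict ℓ₀)
          generates m with e*-generates (coordinates m)
          ... | p , e*p[τ]≈m̂ with restrict-polyActʳ p
          ... | q , agree = q , λ w u u≈q[τH]w → begin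
            app m w                            ≈⟨ app-coordinates m w ⟩
            ⟨ coordinates m , proj₁ w ⟩        ≈⟨ pairing-cong (λ i → sym (e*p[τ]≈m̂ i)) (λ _ → refl) ⟩
            ⟨ polyActʳ p τ e*R , proj₁ w ⟩     ≈⟨ agree (proj₂ w) ⟩
            ⟨ ℓ₀ , polyAct q τH (proj₁ w) ⟩    ≈⟨ pairing-congʳ ℓ₀ u≈q[τH]w ⟨
            ⟨ ℓ₀ , proj₁ u ⟩                   ∎

lemma4p7 : ∀ {c ℓ : Level} (R : CommutativeRing c ℓ) (n : ℕ) (e e* : Fin n → ℤ)
    → pairℤ e* e ≡ + 1
    → (τ : Over.Mat R n)
    → Over.Frame.Stable R e e* τ
    → Σ (Over.Frame.VH R e e*) (λ v → Over.Frame.CyclicVec R e e* τ v)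
      × Σ (Over.Frame.VH* R e e*) (λ l → Over.Frame.CyclicCovec R e e* τ l)
lemma4p7 R n e e* e*e≡1 τ (e-generates , e*-generates) =
  cyclicVector τ e-generates , cyclicCovector τ e*-generates
  where
    open Linear R
    open Hyperplane e e* (fromℤ-pairℤ≡1 e* e e*e≡1)
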